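{- \textsc{SubsetSum} with $n$ items has a static equivalent instance of size $O(n^2\log(n))$.
   Context: A \textsc{SubsetSum} instance consists of $n$ items with weights $w_i\in\mathbb{Z}_{\ge0}$ and a target $C$; a solution is a subset $I'$ of the items with $\sum_{i\in I'}w_i= C$ (the special case of \textsc{Knapsack} where each profit equals the weight and the capacity must be met exactly). A static equivalent instance of an instance is an instance of the same problem having exactly the same set of solutions. Size means binary encoding length. -}

module Defs where

open import Data.Nat using (ℕ; zero; suc; _+_; _*_)
open import Data.Nat.Logarithm using (⌊log₂_⌋)
open import Data.Bool using (Bool; true; false)
open import Data.Vec using (Vec; []; _∷_)
open import Data.Fin.Subset using (Subset)
open import Function.Bundles using (_⇔_)

record SubsetSum (n : ℕ) : Set where
  constructor mkSubsetSum
  field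
    weights : Vec ℕ n
    target  : ℕ
open SubsetSum public

subsetWeight : ∀ {n} → Vec ℕ n → Subset n → ℕ
subsetWeight []       []           = 0
subsetWeight (w ∷ ws) (true  ∷ s)  = w + subsetWeight ws s
subsetWeight (w ∷ ws) (false ∷ s)  = subsetWeight ws s

IsSolution : ∀ {n} → SubsetSum n → Subset n → Set
IsSolution I S = subsetWeight (weights I) S ≡ target I
  where open import Relation.Binary.PropositionalEquality using (_≡_)

StaticEquivalent : ∀ {n} → SubsetSum n → SubsetSum n → Set
StaticEquivalent I J = ∀ S → IsSolution I S ⇔ IsSolution J S

-- Binary encoding length of a natural number (0 takes one bit).
bitLength : ℕ → ℕ
bitLength k = suc ⌊log₂ k ⌋

sumBits : ∀ {n} → Vec ℕ n → ℕ
sumBits []       = 0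
sumBits (w ∷ ws) = bitLength w + sumBits ws

size : ∀ {n} → SubsetSum n → ℕ
size I = sumBits (weights I) + bitLength (target I)

{-# OPTIONS --safe #-}
-- Encode an instance as p = (C, w₁, …, wₙ) ∈ ℤⁿ⁺¹, so that S is a solution iff the row (-1, 1_S) is
-- orthogonal to p. Let R consist of the unit rows and of those rows ±(-1, 1_S) that are nonnegative at p.
-- Every q in the cone K = {x | a · x ≥ 0 for all a ∈ R} that is positive on each row of R positive at p
-- is nonnegative (by the unit rows) and has the same solutions as p, because a row and its negative both
-- lie in R exactly when the row vanishes at p. For each row a positive at p, a simplex-like walk from p
-- produces r ∈ K with a · r > 0 and entries at most (2n + 3)ⁿ⁺¹: every pivot makes one more row tight,
-- the tight rows stay triangular and hence number at most n, and Siegel's lemma supplies a small vector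
-- orthogonal to them. The sum of these at most 1 + n + 2ⁿ⁺¹ rays has entries 2^O(n log n), that is,
-- O(n log n) bits per number.
module Submission where

open import Defs
open import Data.Nat as ℕ using (ℕ; zero; suc; s≤s; z≤n)
import Data.Nat.Properties as ℕ
open import Data.Fin as Fin using (Fin; zero; suc; toℕ)
import Data.Fin.Properties as Fin
open import Data.Vec.Functional using (Vector; tail)
open import Data.Product using (_×_; _,_; ∃-syntax; proj₁; proj₂)
open import Data.Sum using (_⊎_; inj₁; inj₂; [_,_]′)
open import Function using (_∘_; id)
open import Relation.Nullary using (¬_; yes; no)
open import Relation.Binary.PropositionalEquality

module IntegerVectors where

  open import Data.Integer using (ℤ; 0ℤ; 1ℤ; -1ℤ; ∣_∣; _+_; _*_; -_; _-_)
  import Data.Integer.Properties as ℤ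
  open import Algebra.Properties.Semiring.Sum ℤ.+-*-semiring
    using (sum; sum-cong-≗; ∑-distrib-+; *-distribˡ-sum; sum-replicate-zero)
  open import Algebra.Properties.CommutativeSemigroup ℤ.*-commutativeSemigroup
    using (x∙yz≈y∙xz)
  open import Data.Vec.Functional using (_∷_)
  open import Relation.Nullary using (contradiction)

  private variable n : ℕ

  infixl 6 _+ᵥ_ _-ᵥ_
  infixr 7 _*ᵥ_
  infix  9 -ᵥ_
  infix  8 _·_

  0ᵥ : Vector ℤ n
  0ᵥ _ = 0ℤ

  _+ᵥ_ _-ᵥ_ : Vector ℤ n → Vector ℤ n → Vector ℤ n
  (x +ᵥ y) j = x j + y j
  (x -ᵥ y) j = x j - y j

  _*ᵥ_ : ℤ → Vector ℤ n → Vector ℤ n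
  (k *ᵥ x) j = k * x j

  -ᵥ_ : Vector ℤ n → Vector ℤ n
  (-ᵥ x) j = - x j

  NonZeroᵥ : Vector ℤ n → Set
  NonZeroᵥ x = ¬ (x ≗ 0ᵥ)

  _·_ : Vector ℤ n → Vector ℤ n → ℤ
  a · x = sum (λ j → a j * x j)

  ·-comm : (a x : Vector ℤ n) → a · x ≡ x · a
  ·-comm a x = sum-cong-≗ (λ j → ℤ.*-comm (a j) (x j))

  ·-congʳ : (a : Vector ℤ n) {x y : Vector ℤ n} → x ≗ y → a · x ≡ a · y
  ·-congʳ a x≗y = sum-cong-≗ (λ j → cong (a j *_) (x≗y j))

  ·-zeroʳ : (a : Vector ℤ n) → a · 0ᵥ ≡ 0ℤ
  ·-zeroʳ {n} a = trans (sum-cong-≗ (λ j → ℤ.*-zeroʳ (a j))) (sum-replicate-zero n)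

  ·-distribˡ-+ᵥ : (a x y : Vector ℤ n) → a · (x +ᵥ y) ≡ a · x + a · y
  ·-distribˡ-+ᵥ a x y =
    trans (sum-cong-≗ (λ j → ℤ.*-distribˡ-+ (a j) (x j) (y j)))
          (∑-distrib-+ (λ j → a j * x j) (λ j → a j * y j))

  ·-*ᵥ : (a : Vector ℤ n) (k : ℤ) (x : Vector ℤ n) → a · (k *ᵥ x) ≡ k * (a · x)
  ·-*ᵥ a k x = trans (sum-cong-≗ (λ j → x∙yz≈y∙xz (a j) k (x j))) (sym (*-distribˡ-sum k (λ j → a j * x j)))

  ·--ᵥ : (a x : Vector ℤ n) → a · (-ᵥ x) ≡ - (a · x)
  ·--ᵥ a x = begin
    a · (-ᵥ x)        ≡⟨ ·-congʳ a (λ j → sym (ℤ.-1*i≡-i (x j))) ⟩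
    a · (-1ℤ *ᵥ x)    ≡⟨ ·-*ᵥ a -1ℤ x ⟩
    -1ℤ * (a · x)     ≡⟨ ℤ.-1*i≡-i (a · x) ⟩
    - (a · x)         ∎
    where open ≡-Reasoning

  -ᵥ-· : (a x : Vector ℤ n) → (-ᵥ a) · x ≡ - (a · x)
  -ᵥ-· a x = trans (·-comm (-ᵥ a) x) (trans (·--ᵥ x a) (cong -_ (·-comm x a)))

  ·-distribˡ--ᵥ : (a x y : Vector ℤ n) → a · (x -ᵥ y) ≡ a · x - a · y
  ·-distribˡ--ᵥ a x y = trans (·-distribˡ-+ᵥ a x (-ᵥ y)) (cong (_+_ (a · x)) (·--ᵥ a y))

  ·-linear : (a : Vector ℤ n) (k l : ℤ) (x y : Vector ℤ n) →
             a · (k *ᵥ x +ᵥ l *ᵥ y) ≡ k * (a · x) + l * (a · y)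
  ·-linear a k l x y = trans (·-distribˡ-+ᵥ a (k *ᵥ x) (l *ᵥ y)) (cong₂ _+_ (·-*ᵥ a k x) (·-*ᵥ a l y))

  ∣a·x∣≤n*[s*b] : ∀ {s b} (a x : Vector ℤ n) → (∀ j → ∣ a j ∣ ℕ.≤ s) → (∀ j → ∣ x j ∣ ℕ.≤ b) →
                  ∣ a · x ∣ ℕ.≤ n ℕ.* (s ℕ.* b)
  ∣a·x∣≤n*[s*b] {zero}          a x a≤s x≤b = z≤n
  ∣a·x∣≤n*[s*b] {suc n} {s} {b} a x a≤s x≤b = begin
    ∣ a zero * x zero + tail a · tail x ∣         ≤⟨ ℤ.∣i+j∣≤∣i∣+∣j∣ (a zero * x zero) (tail a · tail x) ⟩
    ∣ a zero * x zero ∣ ℕ.+ ∣ tail a · tail x ∣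
      ≡⟨ cong (ℕ._+ ∣ tail a · tail x ∣) (ℤ.∣i*j∣≡∣i∣*∣j∣ (a zero) (x zero)) ⟩
    ∣ a zero ∣ ℕ.* ∣ x zero ∣ ℕ.+ ∣ tail a · tail x ∣
      ≤⟨ ℕ.+-mono-≤ (ℕ.*-mono-≤ (a≤s zero) (x≤b zero))
                    (∣a·x∣≤n*[s*b] (tail a) (tail x) (a≤s ∘ suc) (x≤b ∘ suc)) ⟩
    s ℕ.* b ℕ.+ n ℕ.* (s ℕ.* b)                   ∎
    where open ℕ.≤-Reasoning

  i*j≡0⇒i≡0 : ∀ {i j} → i * j ≡ 0ℤ → j ≢ 0ℤ → i ≡ 0ℤ
  i*j≡0⇒i≡0 {i} ij≡0 j≢0 with ℤ.i*j≡0⇒i≡0∨j≡0 i ij≡0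
  ... | inj₁ i≡0 = i≡0
  ... | inj₂ j≡0 = contradiction j≡0 j≢0

  *ᵥ≗0ᵥ⇒≡0 : ∀ {k} {x : Vector ℤ n} → k *ᵥ x ≗ 0ᵥ → NonZeroᵥ x → k ≡ 0ℤ
  *ᵥ≗0ᵥ⇒≡0 {k = k} kx≗0 x≢0 with k ℤ.≟ 0ℤ
  ... | yes k≡0 = k≡0
  ... | no  k≢0 = contradiction (λ j → i*j≡0⇒i≡0 (trans (ℤ.*-comm _ k) (kx≗0 j)) k≢0) x≢0

  -ᵥ-nonzero : {x : Vector ℤ n} → NonZeroᵥ x → NonZeroᵥ (-ᵥ x)
  -ᵥ-nonzero x≢0 -x≗0 = x≢0 (λ j → ℤ.neg-injective (-x≗0 j))

  Small : Vector ℤ n → Set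
  Small a = ∀ j → ∣ a j ∣ ℕ.≤ 1

  unit : Fin n → Vector ℤ n
  unit zero    = 1ℤ ∷ 0ᵥ
  unit (suc i) = 0ℤ ∷ unit i

  unit-· : (i : Fin n) (x : Vector ℤ n) → unit i · x ≡ x i
  unit-· zero    x = begin
    1ℤ * x zero + 0ᵥ · tail x
      ≡⟨ cong₂ _+_ (ℤ.*-identityˡ (x zero)) (trans (·-comm 0ᵥ (tail x)) (·-zeroʳ (tail x))) ⟩
    x zero + 0ℤ                ≡⟨ ℤ.+-identityʳ (x zero) ⟩
    x zero                     ∎
    where open ≡-Reasoning
  unit-· (suc i) x = trans (ℤ.+-identityˡ (unit i · tail x)) (unit-· i (tail x))

  unit-small : (i : Fin n) → Small (unit i)
  unit-small zero    zero    = ℕ.≤-refl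
  unit-small zero    (suc j) = z≤n
  unit-small (suc i) zero    = z≤n
  unit-small (suc i) (suc j) = unit-small i j

  -ᵥ-small : {a : Vector ℤ n} → Small a → Small (-ᵥ a)
  -ᵥ-small {a = a} a-small j = subst (ℕ._≤ 1) (sym (ℤ.∣-i∣≡∣i∣ (a j))) (a-small j)

module Siegel where

  open IntegerVectors
  open import Data.Integer using (ℤ; +_; -[1+_]; 0ℤ; ∣_∣; _+_; _-_)
  import Data.Integer.Properties as ℤ
  open import Algebra.Properties.AbelianGroup ℤ.+-0-abelianGroup using (∙-cancelʳ)
  open import Algebra.Properties.CommutativeSemigroup ℕ.*-commutativeSemigroup
    using (interchange; x∙yz≈z∙xy)
  open import Data.Vec.Functional using (foldr)

  private variable m n : ℕ

  +∣i+M∣≡i+M : ∀ {M} i → ∣ i ∣ ℕ.≤ M → + ∣ i + + M ∣ ≡ i + + M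
  +∣i+M∣≡i+M (+ k)    _    = refl
  +∣i+M∣≡i+M -[1+ k ] k<M rewrite ℤ.⊖-≥ k<M = refl

  shift : (M : ℕ) (i : ℤ) → ∣ i ∣ ℕ.≤ M → Fin (suc (M ℕ.+ M))
  shift M i i≤M = Fin.fromℕ< (s≤s (ℕ.≤-trans (ℤ.∣i+j∣≤∣i∣+∣j∣ i (+ M)) (ℕ.+-monoˡ-≤ M i≤M)))

  shift-injective : ∀ {M i j} (i≤M : ∣ i ∣ ℕ.≤ M) (j≤M : ∣ j ∣ ℕ.≤ M) →
                    shift M i i≤M ≡ shift M j j≤M → i ≡ j
  shift-injective {M} {i} {j} i≤M j≤M eq = ∙-cancelʳ (+ M) i j (begin
    i + + M        ≡⟨ sym (+∣i+M∣≡i+M i i≤M) ⟩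
    + ∣ i + + M ∣  ≡⟨ cong +_ (trans (sym (Fin.toℕ-fromℕ< _)) (trans (cong toℕ eq) (Fin.toℕ-fromℕ< _))) ⟩
    + ∣ j + + M ∣  ≡⟨ +∣i+M∣≡i+M j j≤M ⟩
    j + + M        ∎)
    where open ≡-Reasoning

  ∣+a-+b∣≤ : ∀ {a b B} → a ℕ.≤ B → b ℕ.≤ B → ∣ + a - + b ∣ ℕ.≤ B
  ∣+a-+b∣≤ {a} {b} a≤B b≤B rewrite ℤ.[+m]-[+n]≡m⊖n a b =
    ℕ.≤-trans (ℤ.∣m⊝n∣≤m⊔n a b) (ℕ.⊔-lub a≤B b≤B)

  funToFin-cong : ∀ {k} {f g : Fin m → Fin k} → f ≗ g → Fin.funToFin f ≡ Fin.funToFin g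
  funToFin-cong {zero}  f≗g = refl
  funToFin-cong {suc m} f≗g = cong₂ Fin.combine (f≗g zero) (funToFin-cong (f≗g ∘ suc))

  finToFun-injective : ∀ {k} {i j : Fin (k ℕ.^ m)} → Fin.finToFun {k} {m} i ≗ Fin.finToFun j → i ≡ j
  finToFun-injective {m} {k} {i} {j} i≗j = begin
    i                                    ≡⟨ sym (Fin.funToFin-finToFin {m} {k} i) ⟩
    Fin.funToFin (Fin.finToFun {k} {m} i) ≡⟨ funToFin-cong i≗j ⟩
    Fin.funToFin (Fin.finToFun {k} {m} j) ≡⟨ Fin.funToFin-finToFin {m} {k} j ⟩
    j                                    ∎
    where open ≡-Reasoning

  ^-distribʳ-* : ∀ a b m → (a ℕ.* b) ℕ.^ m ≡ a ℕ.^ m ℕ.* b ℕ.^ m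
  ^-distribʳ-* a b zero    = refl
  ^-distribʳ-* a b (suc m) =
    trans (cong (a ℕ.* b ℕ.*_) (^-distribʳ-* a b m)) (interchange a b (a ℕ.^ m) (b ℕ.^ m))

  siegelBound : ℕ → ℕ → ℕ
  siegelBound S m = suc (2 ℕ.* S) ℕ.^ m

  -- There are more points in [0, B]ⁿ than possible images in [-BS, BS]ᵐ, as 1 + 2BS ≤ (1 + 2S)(1 + B).
  siegel-count : ∀ S → m ℕ.< n →
                 suc (siegelBound S m ℕ.* S ℕ.+ siegelBound S m ℕ.* S) ℕ.^ m ℕ.< suc (siegelBound S m) ℕ.^ n
  siegel-count {m} {n} S m<n = begin-strict
    suc (B ℕ.* S ℕ.+ B ℕ.* S) ℕ.^ m        ≤⟨ ℕ.^-monoˡ-≤ m images≤ ⟩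
    (suc (2 ℕ.* S) ℕ.* suc B) ℕ.^ m        ≡⟨ ^-distribʳ-* (suc (2 ℕ.* S)) (suc B) m ⟩
    B ℕ.* suc B ℕ.^ m                      <⟨ ℕ.*-monoˡ-< (suc B ℕ.^ m) {{ℕ.m^n≢0 (suc B) m}} (ℕ.n<1+n B) ⟩
    suc B ℕ.^ suc m                        ≤⟨ ℕ.^-monoʳ-≤ (suc B) m<n ⟩
    suc B ℕ.^ n                            ∎
    where
    open ℕ.≤-Reasoning
    B : ℕ
    B = siegelBound S m
    images≤ : suc (B ℕ.* S ℕ.+ B ℕ.* S) ℕ.≤ suc (2 ℕ.* S) ℕ.* suc B
    images≤ = ℕ.≤-trans (ℕ.m≤m+n _ (2 ℕ.* S ℕ.+ B)) (ℕ.≤-reflexive (solve 2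
      (λ B S → con 1 :+ (B :* S :+ B :* S) :+ (con 2 :* S :+ B) := (con 1 :+ con 2 :* S) :* (con 1 :+ B))
      refl B S))
      where open import Data.Nat.Solver using (module +-*-Solver)
            open +-*-Solver

  siegel : m ℕ.< n → (A : Fin m → Vector ℤ n) → ∀ {s} → (∀ i j → ∣ A i j ∣ ℕ.≤ s) →
           ∃[ x ] NonZeroᵥ x × (∀ j → ∣ x j ∣ ℕ.≤ siegelBound (n ℕ.* s) m) × (∀ i → A i · x ≡ 0ℤ)
  siegel {m} {n} m<n A {s} A≤s = from-collision (Fin.pigeonhole (siegel-count S m<n) code)
    where
    S B M : ℕ
    S = n ℕ.* s
    B = siegelBound S m
    M = B ℕ.* S

    point : Fin (suc B ℕ.^ n) → Vector ℤ n
    point k j = + toℕ (Fin.finToFun k j)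

    point≤B : ∀ k j → toℕ (Fin.finToFun k j) ℕ.≤ B
    point≤B k j = ℕ.s≤s⁻¹ (Fin.toℕ<n (Fin.finToFun k j))

    image≤M : ∀ k i → ∣ A i · point k ∣ ℕ.≤ M
    image≤M k i =
      ℕ.≤-trans (∣a·x∣≤n*[s*b] (A i) (point k) (A≤s i) (point≤B k)) (ℕ.≤-reflexive (x∙yz≈z∙xy n s B))

    code : Fin (suc B ℕ.^ n) → Fin (suc (M ℕ.+ M) ℕ.^ m)
    code k = Fin.funToFin (λ i → shift M (A i · point k) (image≤M k i))

    from-collision : ∃[ k ] ∃[ l ] (k Fin.< l × code k ≡ code l) →
      ∃[ x ] NonZeroᵥ x × (∀ j → ∣ x j ∣ ℕ.≤ B) × (∀ i → A i · x ≡ 0ℤ)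
    from-collision (k , l , k<l , same-code) = point k -ᵥ point l , nonzero , bounded , kernel
      where
      same-image : ∀ i → A i · point k ≡ A i · point l
      same-image i = shift-injective (image≤M k i) (image≤M l i) (begin
        _                               ≡⟨ sym (Fin.finToFun-funToFin _ i) ⟩
        Fin.finToFun (code k) i         ≡⟨ cong (λ c → Fin.finToFun c i) same-code ⟩
        Fin.finToFun (code l) i         ≡⟨ Fin.finToFun-funToFin _ i ⟩
        _                               ∎)
        where open ≡-Reasoning
      kernel : ∀ i → A i · (point k -ᵥ point l) ≡ 0ℤ
      kernel i = trans (·-distribˡ--ᵥ (A i) _ _) (ℤ.i≡j⇒i-j≡0 (same-image i))
      nonzero : NonZeroᵥ (point k -ᵥ point l)
      nonzero k-l≗0 = Fin.<-irrefl (finToFun-injective {n} {suc B} λ j →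
        Fin.toℕ-injective (ℤ.+-injective (ℤ.i-j≡0⇒i≡j _ _ (k-l≗0 j)))) k<l
      bounded : ∀ j → ∣ point k j - point l j ∣ ℕ.≤ B
      bounded j = ∣+a-+b∣≤ (point≤B k j) (point≤B l j)

  maxᵥ : Vector ℕ n → ℕ
  maxᵥ = foldr ℕ._⊔_ 0

  ≤-maxᵥ : (x : Vector ℕ n) (j : Fin n) → x j ℕ.≤ maxᵥ x
  ≤-maxᵥ x zero    = ℕ.m≤m⊔n (x zero) _
  ≤-maxᵥ x (suc j) = ℕ.≤-trans (≤-maxᵥ (tail x) j) (ℕ.m≤n⊔m (x zero) _)

  kernel-nontrivial : m ℕ.< n → (A : Fin m → Vector ℤ n) → ∃[ x ] NonZeroᵥ x × (∀ i → A i · x ≡ 0ℤ)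
  kernel-nontrivial m<n A =
    let x , x≢0 , _ , Ax≡0 = siegel m<n A entry≤max in x , x≢0 , Ax≡0
    where
    entry≤max : ∀ i j → ∣ A i j ∣ ℕ.≤ maxᵥ (λ i → maxᵥ (λ j → ∣ A i j ∣))
    entry≤max i j = ℕ.≤-trans (≤-maxᵥ (λ j → ∣ A i j ∣) j) (≤-maxᵥ (λ i → maxᵥ (λ j → ∣ A i j ∣)) i)

module TriangularFamilies where

  open IntegerVectors
  open Siegel using (siegel; siegelBound; kernel-nontrivial)
  open import Data.Integer using (ℤ; 0ℤ; ∣_∣; _+_; _*_; -_)
  import Data.Integer.Properties as ℤ
  open import Algebra.Properties.CommutativeSemigroup ℤ.+-commutativeSemigroup using (xy∙z≈y∙xz)
  open import Data.List using (List; []; _∷_; length; lookup)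
  open import Data.List.Relation.Unary.All as All using (All; []; _∷_)
  import Data.List.Relation.Unary.Any as Any
  open import Data.List.Relation.Unary.Any.Properties using (lookup-index)
  open import Data.List.Membership.Propositional.Properties using (∈-lookup)
  open import Data.Unit using (⊤)
  open import Relation.Nullary using (contradiction)

  private variable
    N : ℕ
    B : List (Vector ℤ N × Vector ℤ N)
    x y : Vector ℤ N

  Tight : List (Vector ℤ N × Vector ℤ N) → Vector ℤ N → Set
  Tight B x = All (λ ar → proj₁ ar · x ≡ 0ℤ) B

  tight-+ᵥ : Tight B x → Tight B y → Tight B (x +ᵥ y)
  tight-+ᵥ {x = x} {y = y} B⊥x B⊥y = All.zipWith (λ {ar} (a·x≡0 , a·y≡0) →
    trans (·-distribˡ-+ᵥ (proj₁ ar) x y) (cong₂ _+_ a·x≡0 a·y≡0)) (B⊥x , B⊥y)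

  tight-*ᵥ : ∀ k → Tight B x → Tight B (k *ᵥ x)
  tight-*ᵥ {x = x} k = All.map λ {ar} a·x≡0 →
    trans (·-*ᵥ (proj₁ ar) k x) (trans (cong (k *_) a·x≡0) (ℤ.*-zeroʳ k))

  tight--ᵥ : Tight B x → Tight B (-ᵥ x)
  tight--ᵥ {x = x} = All.map λ {ar} a·x≡0 → trans (·--ᵥ (proj₁ ar) x) (cong -_ a·x≡0)

  Triangular : List (Vector ℤ N × Vector ℤ N) → Set
  Triangular []            = ⊤
  Triangular ((a , r) ∷ B) = a · r ≢ 0ℤ × Tight B r × Triangular B

  combination : (B : List (Vector ℤ N × Vector ℤ N)) → Vector ℤ (length B) → Vector ℤ N
  combination B c j = c · (λ i → proj₂ (lookup B i) j)

  combination-zero : (B : List (Vector ℤ N × Vector ℤ N)) {c : Vector ℤ (length B)} →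
                     c ≗ 0ᵥ → combination B c ≗ 0ᵥ
  combination-zero B {c} c≗0 j =
    trans (·-comm c Bⱼ) (trans (·-congʳ Bⱼ c≗0) (·-zeroʳ Bⱼ))
    where
    Bⱼ : Vector ℤ (length B)
    Bⱼ i = proj₂ (lookup B i) j

  triangular-independent : (B : List (Vector ℤ N × Vector ℤ N)) → Triangular B → ∀ {z} → Tight B z →
                           (c : Vector ℤ (length B)) → combination B c +ᵥ z ≗ 0ᵥ → c ≗ 0ᵥ
  triangular-independent ((a , r) ∷ B) (a·r≢0 , B⊥r , triangular) {z} (a·z≡0 ∷ B⊥z) c c·B+z≗0 = c≗0
    where
    z′ : Vector ℤ _
    z′ = c zero *ᵥ r +ᵥ z
    c′·B+z′≗0 : combination B (tail c) +ᵥ z′ ≗ 0ᵥ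
    c′·B+z′≗0 j = trans (sym (xy∙z≈y∙xz (c zero * r j) _ (z j))) (c·B+z≗0 j)
    tail≗0 : tail c ≗ 0ᵥ
    tail≗0 = triangular-independent B triangular (tight-+ᵥ (tight-*ᵥ (c zero) B⊥r) B⊥z) (tail c) c′·B+z′≗0
    z′≗0 : z′ ≗ 0ᵥ
    z′≗0 j = trans (sym (trans (cong (_+ z′ j) (combination-zero B tail≗0 j)) (ℤ.+-identityˡ (z′ j))))
                   (c′·B+z′≗0 j)
    c₀*a·r≡0 : c zero * (a · r) ≡ 0ℤ
    c₀*a·r≡0 = begin
      c zero * (a · r)             ≡⟨ sym (ℤ.+-identityʳ _) ⟩
      c zero * (a · r) + 0ℤ        ≡⟨ cong (c zero * (a · r) +_) (sym a·z≡0) ⟩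
      c zero * (a · r) + a · z     ≡⟨ sym (trans (·-distribˡ-+ᵥ a _ z) (cong (_+ a · z) (·-*ᵥ a (c zero) r))) ⟩
      a · z′                       ≡⟨ trans (·-congʳ a z′≗0) (·-zeroʳ a) ⟩
      0ℤ                           ∎
      where open ≡-Reasoning
    c≗0 : c ≗ 0ᵥ
    c≗0 zero    = i*j≡0⇒i≡0 c₀*a·r≡0 a·r≢0
    c≗0 (suc i) = tail≗0 i

  -- p, r₁, …, r_k are linearly independent, and k + 1 > N vectors of ℤᴺ would be dependent by Siegel's lemma.
  triangular-length< : (B : List (Vector ℤ N × Vector ℤ N)) → Triangular B → ∀ {p} → NonZeroᵥ p → Tight B p →
                       length B ℕ.< N
  triangular-length< {N} B triangular {p} p≢0 B⊥p with length B ℕ.<? N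
  ... | yes B<N = B<N
  ... | no  B≮N = dependent (kernel-nontrivial (s≤s (ℕ.≮⇒≥ B≮N)) A)
    where
    column : Fin (suc (length B)) → Vector ℤ N
    column zero    = p
    column (suc i) = proj₂ (lookup B i)
    A : Fin N → Vector ℤ (suc (length B))
    A j i = column i j
    dependent : ∃[ c ] NonZeroᵥ c × (∀ j → A j · c ≡ 0ℤ) → length B ℕ.< N
    dependent (c , c≢0 , Ac≡0) = contradiction c≗0 c≢0
      where
      relation : combination B (tail c) +ᵥ c zero *ᵥ p ≗ 0ᵥ
      relation j = trans (ℤ.+-comm _ (c zero * p j)) (trans (·-comm c (A j)) (Ac≡0 j))
      tail≗0 : tail c ≗ 0ᵥ
      tail≗0 = triangular-independent B triangular (tight-*ᵥ (c zero) B⊥p) (tail c) relation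
      c₀p≗0 : c zero *ᵥ p ≗ 0ᵥ
      c₀p≗0 j = trans (sym (trans (cong (_+ c zero * p j) (combination-zero B tail≗0 j)) (ℤ.+-identityˡ _)))
                      (relation j)
      c≗0 : c ≗ 0ᵥ
      c≗0 zero    = *ᵥ≗0ᵥ⇒≡0 c₀p≗0 p≢0
      c≗0 (suc i) = tail≗0 i

  small-tight-vector : (B : List (Vector ℤ N × Vector ℤ N)) → length B ℕ.< N → All (Small ∘ proj₁) B →
                       ∃[ r ] NonZeroᵥ r × (∀ j → ∣ r j ∣ ℕ.≤ siegelBound N N) × Tight B r
  small-tight-vector {N} B B<N small =
    let r , r≢0 , r≤ , Ar≡0 = siegel B<N (proj₁ ∘ lookup B) (λ i → All.lookup small (∈-lookup i))
    in  r , r≢0 , (λ j → ℕ.≤-trans (r≤ j) bound≤) , All.tabulate λ {ar} ar∈B →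
          subst (λ ar → proj₁ ar · r ≡ 0ℤ) (sym (lookup-index ar∈B)) (Ar≡0 (Any.index ar∈B))
    where
    bound≤ : siegelBound (N ℕ.* 1) (length B) ℕ.≤ siegelBound N N
    bound≤ rewrite ℕ.*-identityʳ N = ℕ.^-monoʳ-≤ (suc (2 ℕ.* N)) (ℕ.<⇒≤ B<N)

module LeastElement where

  open import Data.List using (List; _∷_)
  open import Data.List.Relation.Unary.Any using (Any; here; there; any?)
  open import Data.List.Membership.Propositional using (_∈_; lose)
  open import Relation.Nullary using (contradiction)
  open import Relation.Unary using (Decidable)

  module _ {A : Set} {P : A → Set} (P? : Decidable P) {_≼_ : A → A → Set}
           (≼-refl : ∀ {x} → x ≼ x) (≼-total : ∀ x y → x ≼ y ⊎ y ≼ x)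
           (≼-trans : ∀ {x y z} → P x → P y → P z → x ≼ y → y ≼ z → x ≼ z) where

    IsLeast : List A → A → Set
    IsLeast L m = m ∈ L × P m × (∀ {y} → y ∈ L → P y → m ≼ y)

    private
      cons-least : ∀ {x L} → P x → ∃[ m ] IsLeast L m → ∃[ m ] IsLeast (x ∷ L) m
      cons-least {x} px (m , m∈L , pm , m≼) with ≼-total x m
      ... | inj₁ x≼m = x , here refl , px , λ
        { (here refl) _  → ≼-refl
        ; (there y∈L) py → ≼-trans px pm py x≼m (m≼ y∈L py) }
      ... | inj₂ m≼x = m , there m∈L , pm , λ
        { (here refl) _  → m≼x
        ; (there y∈L) py → m≼ y∈L py }

    least : ∀ {L} → Any P L → ∃[ m ] IsLeast L m
    least {x ∷ L} (here px) with any? P? L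
    ... | yes some = cons-least px (least some)
    ... | no none  = x , here refl , px , λ
      { (here refl) _  → ≼-refl
      ; (there y∈L) py → contradiction (lose y∈L py) none }
    least {x ∷ L} (there some) with P? x
    ... | yes px = cons-least px (least some)
    ... | no ¬px =
      let m , m∈L , pm , m≼ = least some
      in  m , there m∈L , pm , λ
            { (here refl) px → contradiction px ¬px
            ; (there y∈L) py → m≼ y∈L py }

module Cones where

  open IntegerVectors
  open Siegel using (siegelBound)
  open TriangularFamilies
  open LeastElement using (least)
  open import Data.Integer using (ℤ; 0ℤ; ∣_∣; _+_; _*_; -_; _-_; _≤_; _<_; positive; nonNegative)
  import Data.Integer.Properties as ℤ
  open import Algebra.Properties.CommutativeSemigroup ℤ.*-commutativeSemigroup using (x∙yz≈z∙yx)
  open import Data.List using (List; []; _∷_; length)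
  open import Data.List.Relation.Unary.All as All using (All; []; _∷_; all?)
  open import Data.List.Relation.Unary.All.Properties using (¬All⇒Any¬)
  open import Data.List.Relation.Unary.Any as Any using (Any; here; there)
  open import Data.List.Membership.Propositional using (_∈_)
  open import Data.List.Relation.Binary.Subset.Propositional using (_⊆_)
  open import Data.Unit using (tt)
  open import Relation.Nullary using (Dec; contradiction)

  private variable N : ℕ

  InCone : List (Vector ℤ N) → Vector ℤ N → Set
  InCone R x = All (λ a → 0ℤ ≤ a · x) R

  inCone? : (R : List (Vector ℤ N)) (x : Vector ℤ N) → Dec (InCone R x)
  inCone? R x = all? (λ a → 0ℤ ℤ.≤? a · x) R

  outside-cone : (R : List (Vector ℤ N)) {x : Vector ℤ N} → ¬ InCone R x → Any (λ a → a · x < 0ℤ) R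
  outside-cone R {x} x∉K = Any.map ℤ.≰⇒> (¬All⇒Any¬ (λ a → 0ℤ ℤ.≤? a · x) R x∉K)

  inCone-+ᵥ : {R : List (Vector ℤ N)} {x y : Vector ℤ N} → InCone R x → InCone R y → InCone R (x +ᵥ y)
  inCone-+ᵥ {x = x} {y} x∈K y∈K = All.zipWith (λ {a} (0≤ax , 0≤ay) →
    subst (0ℤ ≤_) (sym (·-distribˡ-+ᵥ a x y)) (ℤ.+-mono-≤ 0≤ax 0≤ay)) (x∈K , y∈K)

  ·-+ᵥ-positiveˡ : (a x y : Vector ℤ N) → 0ℤ < a · x → 0ℤ ≤ a · y → 0ℤ < a · (x +ᵥ y)
  ·-+ᵥ-positiveˡ a x y 0<a·x 0≤a·y = subst (0ℤ <_) (sym (·-distribˡ-+ᵥ a x y)) (ℤ.+-mono-<-≤ 0<a·x 0≤a·y)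

  ·-+ᵥ-positiveʳ : (a x y : Vector ℤ N) → 0ℤ ≤ a · x → 0ℤ < a · y → 0ℤ < a · (x +ᵥ y)
  ·-+ᵥ-positiveʳ a x y 0≤a·x 0<a·y = subst (0ℤ <_) (sym (·-distribˡ-+ᵥ a x y)) (ℤ.+-mono-≤-< 0≤a·x 0<a·y)

  Covers : (R L : List (Vector ℤ N)) → Vector ℤ N → Vector ℤ N → Set
  Covers R L p q = InCone R q × (∀ {a} → a ∈ L → 0ℤ < a · p → 0ℤ < a · q)

  Pointed : List (Vector ℤ N) → Set
  Pointed R = ∀ {x} → All (λ a → a · x ≡ 0ℤ) R → x ≗ 0ᵥ

  0≤i*j : ∀ {i j} → 0ℤ ≤ i → 0ℤ ≤ j → 0ℤ ≤ i * j
  0≤i*j {i} {j} 0≤i 0≤j = subst (_≤ i * j) (ℤ.*-zeroʳ i) (ℤ.*-monoˡ-≤-nonNeg i {{nonNegative 0≤i}} 0≤j)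

  0<i*j : ∀ {i j} → 0ℤ < i → 0ℤ < j → 0ℤ < i * j
  0<i*j {i} {j} 0<i 0<j = subst (_< i * j) (ℤ.*-zeroʳ i) (ℤ.*-monoˡ-<-pos i {{positive 0<i}} 0<j)

  cross-≤-trans : ∀ {u₁ u₂ u₃ v₁ v₂ v₃} → 0ℤ ≤ v₁ → 0ℤ < v₂ → 0ℤ ≤ v₃ →
                  u₁ * v₂ ≤ u₂ * v₁ → u₂ * v₃ ≤ u₃ * v₂ → u₁ * v₃ ≤ u₃ * v₁
  cross-≤-trans {u₁} {u₂} {u₃} {v₁} {v₂} {v₃} 0≤v₁ 0<v₂ 0≤v₃ 12≤21 23≤32 =
    ℤ.*-cancelˡ-≤-pos (u₁ * v₃) (u₃ * v₁) v₂ {{positive 0<v₂}} (begin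
      v₂ * (u₁ * v₃)  ≡⟨ x∙yz≈z∙yx v₂ u₁ v₃ ⟩
      v₃ * (u₁ * v₂)  ≤⟨ ℤ.*-monoˡ-≤-nonNeg v₃ {{nonNegative 0≤v₃}} 12≤21 ⟩
      v₃ * (u₂ * v₁)  ≡⟨ x∙yz≈z∙yx v₃ u₂ v₁ ⟩
      v₁ * (u₂ * v₃)  ≤⟨ ℤ.*-monoˡ-≤-nonNeg v₁ {{nonNegative 0≤v₁}} 23≤32 ⟩
      v₁ * (u₃ * v₂)  ≡⟨ x∙yz≈z∙yx v₁ u₃ v₂ ⟩
      v₂ * (u₃ * v₁)  ∎)
    where open ℤ.≤-Reasoning

  -- The ratio test of the simplex method: moving from p in direction r, the row a₁ with the least
  -- ratio (a₁ · p) / -(a₁ · r) among the rows with a · r < 0 is the first constraint to become tight.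
  _≼⟨_,_⟩_ : Vector ℤ N → Vector ℤ N → Vector ℤ N → Vector ℤ N → Set
  a ≼⟨ p , r ⟩ b = a · p * - (b · r) ≤ b · p * - (a · r)

  least-ratio : {R : List (Vector ℤ N)} {p r : Vector ℤ N} → Any (λ a → a · r < 0ℤ) R →
                ∃[ a₁ ] a₁ ∈ R × a₁ · r < 0ℤ × (∀ {a} → a ∈ R → a · r < 0ℤ → a₁ ≼⟨ p , r ⟩ a)
  least-ratio {p = p} {r} = least (λ a → a · r ℤ.<? 0ℤ) {λ a b → a ≼⟨ p , r ⟩ b}
    ℤ.≤-refl (λ a b → ℤ.≤-total (a · p * - (b · r)) (b · p * - (a · r)))
    (λ {a} {b} {c} ar<0 br<0 cr<0 → cross-≤-trans {a · p} {b · p} {c · p}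
      (ℤ.<⇒≤ (ℤ.neg-mono-< ar<0)) (ℤ.neg-mono-< br<0) (ℤ.<⇒≤ (ℤ.neg-mono-< cr<0)))

  pivotPoint : Vector ℤ N → Vector ℤ N → Vector ℤ N → Vector ℤ N
  pivotPoint p r a₁ = - (a₁ · r) *ᵥ p +ᵥ (a₁ · p) *ᵥ r

  pivotPoint-tight : (p r a₁ : Vector ℤ N) → a₁ · pivotPoint p r a₁ ≡ 0ℤ
  pivotPoint-tight p r a₁ = begin
    a₁ · pivotPoint p r a₁                      ≡⟨ ·-linear a₁ (- (a₁ · r)) (a₁ · p) p r ⟩
    - (a₁ · r) * (a₁ · p) + a₁ · p * (a₁ · r)   ≡⟨ cong (_+ a₁ · p * (a₁ · r)) (sym (ℤ.neg-distribˡ-* (a₁ · r) (a₁ · p))) ⟩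
    - (a₁ · r * (a₁ · p)) + a₁ · p * (a₁ · r)   ≡⟨ cong (λ t → - t + a₁ · p * (a₁ · r)) (ℤ.*-comm (a₁ · r) (a₁ · p)) ⟩
    - (a₁ · p * (a₁ · r)) + a₁ · p * (a₁ · r)   ≡⟨ ℤ.+-inverseˡ (a₁ · p * (a₁ · r)) ⟩
    0ℤ                                          ∎
    where open ≡-Reasoning

  pivotPoint-inCone : {R : List (Vector ℤ N)} {p r a₁ : Vector ℤ N} → InCone R p → 0ℤ ≤ a₁ · p → a₁ · r < 0ℤ →
                      (∀ {a} → a ∈ R → a · r < 0ℤ → a₁ ≼⟨ p , r ⟩ a) → InCone R (pivotPoint p r a₁)
  pivotPoint-inCone {R = R} {p} {r} {a₁} p∈K 0≤a₁p a₁r<0 a₁-least = All.tabulate λ {a} a∈R →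
    subst (0ℤ ≤_) (sym (·-linear a (- (a₁ · r)) (a₁ · p) p r)) (nonneg a∈R (a · r ℤ.<? 0ℤ))
    where
    0≤-a₁r : 0ℤ ≤ - (a₁ · r)
    0≤-a₁r = ℤ.<⇒≤ (ℤ.neg-mono-< a₁r<0)
    nonneg : ∀ {a} → a ∈ R → Dec (a · r < 0ℤ) → 0ℤ ≤ - (a₁ · r) * (a · p) + a₁ · p * (a · r)
    nonneg {a} a∈R (yes ar<0) = subst (0ℤ ≤_) rearrange (ℤ.i≤j⇒0≤j-i (a₁-least a∈R ar<0))
      where
      rearrange : a · p * - (a₁ · r) - a₁ · p * - (a · r) ≡ - (a₁ · r) * (a · p) + a₁ · p * (a · r)
      rearrange = solve 4 (λ u v u₁ v₁ → u :* (:- v₁) :- u₁ :* (:- v) := (:- v₁) :* u :+ u₁ :* v)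
                          refl (a · p) (a · r) (a₁ · p) (a₁ · r)
        where open import Data.Integer.Solver using (module +-*-Solver)
              open +-*-Solver
    nonneg {a} a∈R (no ar≮0) =
      ℤ.+-mono-≤ (0≤i*j 0≤-a₁r (All.lookup p∈K a∈R)) (0≤i*j 0≤a₁p (ℤ.≮⇒≥ ar≮0))

  pivotPoint-positive : {a₀ p r a₁ : Vector ℤ N} → 0ℤ < a₀ · p → 0ℤ ≤ a₀ · r → a₁ · r < 0ℤ → 0ℤ ≤ a₁ · p →
                        0ℤ < a₀ · pivotPoint p r a₁
  pivotPoint-positive {a₀ = a₀} {p} {r} {a₁} 0<a₀p 0≤a₀r a₁r<0 0≤a₁p =
    subst (0ℤ <_) (sym (·-linear a₀ (- (a₁ · r)) (a₁ · p) p r))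
    (ℤ.+-mono-<-≤ (0<i*j (ℤ.neg-mono-< a₁r<0) 0<a₀p) (0≤i*j 0≤a₁p 0≤a₀r))

  module _ {R : List (Vector ℤ N)} (R-small : All Small R) (R-pointed : Pointed R) where

    rayBound : ℕ
    rayBound = siegelBound N N

    module _ (a₀ : Vector ℤ N) where

      SmallRay : Set
      SmallRay = ∃[ r ] InCone R r × 0ℤ < a₀ · r × (∀ j → ∣ r j ∣ ℕ.≤ rayBound)

      Exit : List (Vector ℤ N × Vector ℤ N) → Set
      Exit B = ∃[ r ] Tight B r × 0ℤ ≤ a₀ · r × Any (λ a → a · r < 0ℤ) R

      private
        oriented : ∀ {B r} → NonZeroᵥ r → (∀ j → ∣ r j ∣ ℕ.≤ rayBound) → Tight B r → 0ℤ ≤ a₀ · r →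
                   SmallRay ⊎ Exit B
        oriented {r = r} r≢0 r≤ B⊥r 0≤a₀r with inCone? R r
        ... | no r∉K = inj₂ (r , B⊥r , 0≤a₀r , outside-cone R r∉K)
        ... | yes r∈K with 0ℤ ℤ.<? a₀ · r
        ...   | yes 0<a₀r = inj₁ (r , r∈K , 0<a₀r , r≤)
        ...   | no 0≮a₀r with inCone? R (-ᵥ r)
        ...     | yes -r∈K = contradiction (R-pointed (All.zipWith (λ {a} (0≤ar , 0≤a-r) →
                    ℤ.≤-antisym (ℤ.neg-cancel-≤ (subst (0ℤ ≤_) (·--ᵥ a r) 0≤a-r)) 0≤ar) (r∈K , -r∈K))) r≢0
        ...     | no -r∉K  = inj₂ (-ᵥ r , tight--ᵥ B⊥r , 0≤a₀-r , outside-cone R -r∉K)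
          where
          0≤a₀-r : 0ℤ ≤ a₀ · (-ᵥ r)
          0≤a₀-r = subst (0ℤ ≤_) (sym (trans (·--ᵥ a₀ r) (cong -_ (ℤ.≤-antisym (ℤ.≮⇒≥ 0≮a₀r) 0≤a₀r)))) ℤ.≤-refl

      ray-or-exit : ∀ {B} → ∃[ r ] NonZeroᵥ r × (∀ j → ∣ r j ∣ ℕ.≤ rayBound) × Tight B r →
                    SmallRay ⊎ Exit B
      ray-or-exit (r , r≢0 , r≤ , B⊥r) with ℤ.≤-total 0ℤ (a₀ · r)
      ... | inj₁ 0≤a₀r = oriented r≢0 r≤ B⊥r 0≤a₀r
      ... | inj₂ a₀r≤0 = oriented (-ᵥ-nonzero r≢0)
        (λ j → subst (ℕ._≤ rayBound) (sym (ℤ.∣-i∣≡∣i∣ (r j))) (r≤ j))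
        (tight--ᵥ B⊥r) (subst (0ℤ ≤_) (sym (·--ᵥ a₀ r)) (ℤ.neg-mono-≤ a₀r≤0))

      record PivotState : Set where
        field
          pairs       : List (Vector ℤ N × Vector ℤ N)
          triangular  : Triangular pairs
          rows-small  : All (Small ∘ proj₁) pairs
          point       : Vector ℤ N
          inCone      : InCone R point
          a₀-positive : 0ℤ < a₀ · point
          tight       : Tight pairs point

        pairs-length< : length pairs ℕ.< N
        pairs-length< = triangular-length< pairs triangular
          (λ p≗0 → ℤ.<-irrefl (sym (trans (·-congʳ a₀ p≗0) (·-zeroʳ a₀))) a₀-positive) tight

      open PivotState

      pivot : (F : PivotState) → Exit (pairs F) → PivotState
      pivot F (r , B⊥r , 0≤a₀r , some-negative) =
        let p = point F
            a₁ , a₁∈R , a₁r<0 , a₁-least = least-ratio {p = p} some-negative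
            0≤a₁p = All.lookup (inCone F) a₁∈R
        in record
          { pairs       = (a₁ , r) ∷ pairs F
          ; triangular  = ℤ.<⇒≢ a₁r<0 , B⊥r , triangular F
          ; rows-small  = All.lookup R-small a₁∈R ∷ rows-small F
          ; point       = pivotPoint p r a₁
          ; inCone      = pivotPoint-inCone {p = p} {r} {a₁} (inCone F) 0≤a₁p a₁r<0 a₁-least
          ; a₀-positive = pivotPoint-positive {a₀ = a₀} {p} {r} {a₁} (a₀-positive F) 0≤a₀r a₁r<0 0≤a₁p
          ; tight       = pivotPoint-tight p r a₁ ∷
                          tight-+ᵥ (tight-*ᵥ (- (a₁ · r)) (tight F)) (tight-*ᵥ (a₁ · p) B⊥r)
          }

      -- Every pivot makes one more row tight, and triangular-length< caps the number of tight rows below N.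
      walk : ∀ fuel (F : PivotState) → N ℕ.≤ length (pairs F) ℕ.+ fuel → SmallRay
      walk zero    F N≤B   =
        contradiction (subst (N ℕ.≤_) (ℕ.+-identityʳ (length (pairs F))) N≤B) (ℕ.<⇒≱ (pairs-length< F))
      walk (suc f) F N≤B+f =
        [ id , continue ]′ (ray-or-exit (small-tight-vector (pairs F) (pairs-length< F) (rows-small F)))
        where
        continue : Exit (pairs F) → SmallRay
        continue exit = walk f (pivot F exit) (subst (N ℕ.≤_) (ℕ.+-suc (length (pairs F)) f) N≤B+f)

      small-ray : ∀ {p} → InCone R p → 0ℤ < a₀ · p → SmallRay
      small-ray {p} p∈K 0<a₀p = walk N start ℕ.≤-refl
        where
        start : PivotState
        start = record { pairs = [] ; triangular = tt ; rows-small = [] ; point = p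
                       ; inCone = p∈K ; a₀-positive = 0<a₀p ; tight = [] }

    small-cover : ∀ {p} → InCone R p → (L : List (Vector ℤ N)) → L ⊆ R →
                  ∃[ q ] Covers R L p q × (∀ j → ∣ q j ∣ ℕ.≤ length L ℕ.* rayBound)
    small-cover p∈K []      _ =
      0ᵥ , (All.tabulate (λ {a} _ → ℤ.≤-reflexive (sym (·-zeroʳ a))) , λ ()) , λ _ → z≤n
    small-cover {p} p∈K (a ∷ L) a∷L⊆R with small-cover p∈K L (a∷L⊆R ∘ there) | 0ℤ ℤ.<? a · p
    ... | q , (q∈K , q-positive) , q≤ | no 0≮a·p =
      q , (q∈K , positive-on-a∷L) , λ j → ℕ.≤-trans (q≤ j) (ℕ.m≤n+m _ rayBound)
      where
      positive-on-a∷L : ∀ {b} → b ∈ a ∷ L → 0ℤ < b · p → 0ℤ < b · q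
      positive-on-a∷L (here refl) 0<a·p = contradiction 0<a·p 0≮a·p
      positive-on-a∷L (there b∈L)       = q-positive b∈L
    ... | q , (q∈K , q-positive) , q≤ | yes 0<a·p = add (small-ray a p∈K 0<a·p)
      where
      add : SmallRay a → ∃[ q′ ] Covers R (a ∷ L) p q′ × (∀ j → ∣ q′ j ∣ ℕ.≤ suc (length L) ℕ.* rayBound)
      add (r , r∈K , 0<a·r , r≤) = q +ᵥ r , (inCone-+ᵥ q∈K r∈K , positive-on-a∷L) , bounded
        where
        positive-on-a∷L : ∀ {b} → b ∈ a ∷ L → 0ℤ < b · p → 0ℤ < b · (q +ᵥ r)
        positive-on-a∷L (here refl)  _    = ·-+ᵥ-positiveʳ a q r (All.lookup q∈K (a∷L⊆R (here refl))) 0<a·r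
        positive-on-a∷L {b} (there b∈L) 0<b·p =
          ·-+ᵥ-positiveˡ b q r (q-positive b∈L 0<b·p) (All.lookup r∈K (a∷L⊆R (there b∈L)))
        bounded : ∀ j → ∣ q j + r j ∣ ℕ.≤ suc (length L) ℕ.* rayBound
        bounded j = ℕ.≤-trans (ℤ.∣i+j∣≤∣i∣+∣j∣ (q j) (r j))
          (ℕ.≤-trans (ℕ.+-mono-≤ (q≤ j) (r≤ j)) (ℕ.≤-reflexive (ℕ.+-comm (length L ℕ.* rayBound) rayBound)))

module Reduction where

  open IntegerVectors
  open Siegel using (siegelBound)
  open Cones
  open import Data.Integer using (ℤ; +_; 0ℤ; 1ℤ; -1ℤ; ∣_∣; _+_; _*_; -_; _-_; _≤_; _<_; +≤+)
  import Data.Integer.Properties as ℤ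
  open import Data.Bool using (true; false; if_then_else_)
  open import Data.Vec as Vec using (Vec; []; _∷_)
  import Data.Vec.Properties as Vec
  open import Data.Fin.Subset using (Subset)
  open import Data.List using (List; []; _∷_; _++_; map; length; allFin; filter)
  import Data.List.Properties as List
  open import Data.List.Relation.Unary.All as All using (All)
  import Data.List.Relation.Unary.All.Properties as All
  open import Data.List.Relation.Unary.Any using (here)
  open import Data.List.Membership.Propositional using (_∈_)
  open import Data.List.Membership.Propositional.Properties using (∈-map⁺; ∈-++⁺ˡ; ∈-++⁺ʳ; ∈-allFin; ∈-filter⁺)
  open import Data.Nat.Logarithm using (⌊log₂⌋-mono-≤)
  open import Function.Bundles using (_⇔_; mk⇔)
  import Function.Properties.Equivalence as ⇔
  open import Relation.Binary.Definitions using (tri<; tri≈; tri>)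
  open import Relation.Nullary using (contradiction)

  private variable n : ℕ

  embed : SubsetSum n → Vector ℤ (suc n)
  embed I zero    = + target I
  embed I (suc j) = + Vec.lookup (weights I) j

  indicator : Subset n → Vector ℤ n
  indicator S j = if Vec.lookup S j then 1ℤ else 0ℤ

  indicator-· : (w : Vec ℕ n) (S : Subset n) → indicator S · (λ j → + Vec.lookup w j) ≡ + subsetWeight w S
  indicator-· []       []          = refl
  indicator-· (w ∷ ws) (true  ∷ S) = begin
    1ℤ * + w + indicator S · (λ j → + Vec.lookup ws j)  ≡⟨ cong₂ _+_ (ℤ.*-identityˡ (+ w)) (indicator-· ws S) ⟩
    + w + + subsetWeight ws S                           ≡⟨ sym (ℤ.pos-+ w (subsetWeight ws S)) ⟩
    + (w ℕ.+ subsetWeight ws S)                         ∎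
    where open ≡-Reasoning
  indicator-· (w ∷ ws) (false ∷ S) = trans (ℤ.+-identityˡ _) (indicator-· ws S)

  balance : Subset n → Vector ℤ (suc n)
  balance S zero    = -1ℤ
  balance S (suc j) = indicator S j

  balance-embed : (I : SubsetSum n) (S : Subset n) →
                  balance S · embed I ≡ + subsetWeight (weights I) S - + target I
  balance-embed I S = begin
    -1ℤ * + target I + indicator S · (λ j → + Vec.lookup (weights I) j)
      ≡⟨ cong₂ _+_ (ℤ.-1*i≡-i (+ target I)) (indicator-· (weights I) S) ⟩
    - + target I + + subsetWeight (weights I) S
      ≡⟨ ℤ.+-comm (- + target I) _ ⟩
    + subsetWeight (weights I) S - + target I  ∎
    where open ≡-Reasoning

  isSolution⇔balanced : (I : SubsetSum n) (S : Subset n) → IsSolution I S ⇔ balance S · embed I ≡ 0ℤ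
  isSolution⇔balanced I S = mk⇔
    (λ w≡C → trans (balance-embed I S) (ℤ.i≡j⇒i-j≡0 (cong +_ w≡C)))
    (λ b≡0 → ℤ.+-injective (ℤ.i-j≡0⇒i≡j _ _ (trans (sym (balance-embed I S)) b≡0)))

  balance-small : (S : Subset n) → Small (balance S)
  balance-small S zero    = ℕ.≤-refl
  balance-small S (suc j) with Vec.lookup S j
  ... | true  = ℕ.≤-refl
  ... | false = z≤n

  subsets : ∀ n → List (Subset n)
  subsets zero    = [] ∷ []
  subsets (suc n) = map (true ∷_) (subsets n) ++ map (false ∷_) (subsets n)

  ∈-subsets : (S : Subset n) → S ∈ subsets n
  ∈-subsets []          = here refl
  ∈-subsets (true  ∷ S) = ∈-++⁺ˡ (∈-map⁺ (true ∷_) (∈-subsets S))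
  ∈-subsets (false ∷ S) = ∈-++⁺ʳ (map (true ∷_) (subsets _)) (∈-map⁺ (false ∷_) (∈-subsets S))

  length-subsets : ∀ n → length (subsets n) ≡ 2 ℕ.^ n
  length-subsets zero    = refl
  length-subsets (suc n) = begin
    length (map (true ∷_) (subsets n) ++ map (false ∷_) (subsets n))  ≡⟨ List.length-++ (map (true ∷_) (subsets n)) ⟩
    length (map (true ∷_) (subsets n)) ℕ.+ length (map (false ∷_) (subsets n))
      ≡⟨ cong₂ ℕ._+_ (List.length-map (true ∷_) (subsets n)) (List.length-map (false ∷_) (subsets n)) ⟩
    length (subsets n) ℕ.+ length (subsets n)                          ≡⟨ cong (λ k → k ℕ.+ k) (length-subsets n) ⟩
    2 ℕ.^ n ℕ.+ 2 ℕ.^ n                                                ≡⟨ cong (2 ℕ.^ n ℕ.+_) (sym (ℕ.+-identityʳ _)) ⟩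
    2 ℕ.^ suc n                                                        ∎
    where open ≡-Reasoning

  candidates : ∀ n → List (Vector ℤ (suc n))
  candidates n = map unit (allFin (suc n)) ++ map balance (subsets n) ++ map (-ᵥ_ ∘ balance) (subsets n)

  candidateCount : ℕ → ℕ
  candidateCount n = suc n ℕ.+ (2 ℕ.^ n ℕ.+ 2 ℕ.^ n)

  length-candidates : ∀ n → length (candidates n) ≡ candidateCount n
  length-candidates n = begin
    length (candidates n)
      ≡⟨ List.length-++ (map unit (allFin (suc n))) ⟩
    length (map unit (allFin (suc n))) ℕ.+ length (map balance (subsets n) ++ map (-ᵥ_ ∘ balance) (subsets n))
      ≡⟨ cong₂ ℕ._+_ (trans (List.length-map unit (allFin (suc n))) (List.length-tabulate {n = suc n} id))
                     (List.length-++ (map balance (subsets n))) ⟩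
    suc n ℕ.+ (length (map balance (subsets n)) ℕ.+ length (map (-ᵥ_ ∘ balance) (subsets n)))
      ≡⟨ cong (λ k → suc n ℕ.+ k) (cong₂ ℕ._+_ (List.length-map balance (subsets n))
                                               (List.length-map (-ᵥ_ ∘ balance) (subsets n))) ⟩
    suc n ℕ.+ (length (subsets n) ℕ.+ length (subsets n))
      ≡⟨ cong (λ k → suc n ℕ.+ (k ℕ.+ k)) (length-subsets n) ⟩
    candidateCount n ∎
    where open ≡-Reasoning

  unit-∈-candidates : (j : Fin (suc n)) → unit j ∈ candidates n
  unit-∈-candidates j = ∈-++⁺ˡ (∈-map⁺ unit (∈-allFin j))

  balance-∈-candidates : (S : Subset n) → balance S ∈ candidates n
  balance-∈-candidates S = ∈-++⁺ʳ (map unit (allFin _)) (∈-++⁺ˡ (∈-map⁺ balance (∈-subsets S)))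

  -balance-∈-candidates : (S : Subset n) → -ᵥ balance S ∈ candidates n
  -balance-∈-candidates S =
    ∈-++⁺ʳ (map unit (allFin _)) (∈-++⁺ʳ (map balance (subsets _)) (∈-map⁺ (-ᵥ_ ∘ balance) (∈-subsets S)))

  candidates-small : ∀ n → All Small (candidates n)
  candidates-small n = All.++⁺ (All.map⁺ (All.universal unit-small (allFin (suc n))))
    (All.++⁺ (All.map⁺ (All.universal balance-small (subsets n)))
             (All.map⁺ (All.universal (λ S → -ᵥ-small {a = balance S} (balance-small S)) (subsets n))))

  constraints : SubsetSum n → List (Vector ℤ (suc n))
  constraints {n} I = filter (λ a → 0ℤ ℤ.≤? a · embed I) (candidates n)

  ∈-constraints : (I : SubsetSum n) {a : Vector ℤ (suc n)} →
                  a ∈ candidates n → 0ℤ ≤ a · embed I → a ∈ constraints I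
  ∈-constraints I = ∈-filter⁺ (λ a → 0ℤ ℤ.≤? a · embed I)

  unit-∈-constraints : (I : SubsetSum n) (j : Fin (suc n)) → unit j ∈ constraints I
  unit-∈-constraints I j =
    ∈-constraints I (unit-∈-candidates j) (subst (0ℤ ≤_) (sym (unit-· j (embed I))) (nonneg j))
    where
    nonneg : ∀ j → 0ℤ ≤ embed I j
    nonneg zero    = +≤+ z≤n
    nonneg (suc j) = +≤+ z≤n

  embed-inCone : (I : SubsetSum n) → InCone (constraints I) (embed I)
  embed-inCone {n} I = All.all-filter (λ a → 0ℤ ℤ.≤? a · embed I) (candidates n)

  constraints-small : (I : SubsetSum n) → All Small (constraints I)
  constraints-small {n} I = All.filter⁺ (λ a → 0ℤ ℤ.≤? a · embed I) (candidates-small n)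

  constraints-pointed : (I : SubsetSum n) → Pointed (constraints I)
  constraints-pointed I {x} ·x≡0 j = trans (sym (unit-· j x)) (All.lookup ·x≡0 (unit-∈-constraints I j))

  instanceOf : Vector ℤ (suc n) → SubsetSum n
  instanceOf q = mkSubsetSum (Vec.tabulate (λ j → ∣ q (suc j) ∣)) ∣ q zero ∣

  embed-instanceOf : {q : Vector ℤ (suc n)} → (∀ j → 0ℤ ≤ q j) → embed (instanceOf q) ≗ q
  embed-instanceOf         q≥0 zero    = ℤ.0≤i⇒+∣i∣≡i (q≥0 zero)
  embed-instanceOf {q = q} q≥0 (suc j) =
    trans (cong +_ (Vec.lookup∘tabulate (λ j → ∣ q (suc j) ∣) j)) (ℤ.0≤i⇒+∣i∣≡i (q≥0 (suc j)))

  bitLength-mono-≤ : ∀ {k l} → k ℕ.≤ l → bitLength k ℕ.≤ bitLength l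
  bitLength-mono-≤ = s≤s ∘ ⌊log₂⌋-mono-≤

  sumBits-tabulate-≤ : ∀ {M} (f : Fin n → ℕ) → (∀ j → f j ℕ.≤ M) →
                       sumBits (Vec.tabulate f) ℕ.≤ n ℕ.* bitLength M
  sumBits-tabulate-≤ {zero}  f f≤M = z≤n
  sumBits-tabulate-≤ {suc n} f f≤M =
    ℕ.+-mono-≤ (bitLength-mono-≤ (f≤M zero)) (sumBits-tabulate-≤ (f ∘ suc) (f≤M ∘ suc))

  size-instanceOf : ∀ {M} (q : Vector ℤ (suc n)) → (∀ j → ∣ q j ∣ ℕ.≤ M) →
                    size (instanceOf q) ℕ.≤ suc n ℕ.* bitLength M
  size-instanceOf {n} {M} q q≤M = ℕ.≤-trans
    (ℕ.+-mono-≤ (sumBits-tabulate-≤ (λ j → ∣ q (suc j) ∣) (q≤M ∘ suc)) (bitLength-mono-≤ (q≤M zero)))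
    (ℕ.≤-reflexive (ℕ.+-comm (n ℕ.* bitLength M) (bitLength M)))

  module _ (I : SubsetSum n) {q : Vector ℤ (suc n)}
           (q-covers : Covers (constraints I) (constraints I) (embed I) q) where

    private
      q∈K : InCone (constraints I) q
      q∈K = proj₁ q-covers
      q-positive : ∀ {a} → a ∈ constraints I → 0ℤ < a · embed I → 0ℤ < a · q
      q-positive = proj₂ q-covers

    balanced-transfer : (S : Subset n) → balance S · embed I ≡ 0ℤ ⇔ balance S · q ≡ 0ℤ
    balanced-transfer S = mk⇔ forward backward
      where
      v : Vector ℤ (suc n)
      v = balance S
      -v·≡ : ∀ x → v · x ≡ 0ℤ → (-ᵥ v) · x ≡ 0ℤ
      -v·≡ x v·x≡0 = trans (-ᵥ-· v x) (cong -_ v·x≡0)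
      forward : v · embed I ≡ 0ℤ → v · q ≡ 0ℤ
      forward v·p≡0 = ℤ.≤-antisym
        (ℤ.neg-cancel-≤ (subst (0ℤ ≤_) (-ᵥ-· v q) (All.lookup q∈K
          (∈-constraints I (-balance-∈-candidates S) (ℤ.≤-reflexive (sym (-v·≡ (embed I) v·p≡0)))))))
        (All.lookup q∈K (∈-constraints I (balance-∈-candidates S) (ℤ.≤-reflexive (sym v·p≡0))))
      backward : v · q ≡ 0ℤ → v · embed I ≡ 0ℤ
      backward v·q≡0 with ℤ.<-cmp 0ℤ (v · embed I)
      ... | tri≈ _ 0≡v·p _ = sym 0≡v·p
      ... | tri< 0<v·p _ _ = contradiction
        (q-positive (∈-constraints I (balance-∈-candidates S) (ℤ.<⇒≤ 0<v·p)) 0<v·p)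
        (ℤ.<-irrefl (sym v·q≡0))
      ... | tri> _ _ v·p<0 = contradiction
        (q-positive (∈-constraints I (-balance-∈-candidates S) (ℤ.<⇒≤ 0<-v·p)) 0<-v·p)
        (ℤ.<-irrefl (sym (-v·≡ q v·q≡0)))
        where
        0<-v·p : 0ℤ < (-ᵥ v) · embed I
        0<-v·p = subst (0ℤ <_) (sym (-ᵥ-· v (embed I))) (ℤ.neg-mono-< v·p<0)

    instanceOf-equivalent : StaticEquivalent I (instanceOf q)
    instanceOf-equivalent S = ⇔.trans (isSolution⇔balanced I S) (⇔.trans (balanced-transfer S)
      (⇔.sym (⇔.trans (isSolution⇔balanced (instanceOf q) S) same-product)))
      where
      q≥0 : ∀ j → 0ℤ ≤ q j
      q≥0 j = subst (0ℤ ≤_) (unit-· j q) (All.lookup q∈K (unit-∈-constraints I j))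
      same-product : balance S · embed (instanceOf q) ≡ 0ℤ ⇔ balance S · q ≡ 0ℤ
      same-product = mk⇔ (trans (sym b·J≡b·q)) (trans b·J≡b·q)
        where
        b·J≡b·q : balance S · embed (instanceOf q) ≡ balance S · q
        b·J≡b·q = ·-congʳ (balance S) (embed-instanceOf q≥0)

  small-static-equivalent : (I : SubsetSum n) → ∃[ J ] StaticEquivalent I J ×
    size J ℕ.≤ suc n ℕ.* bitLength (candidateCount n ℕ.* siegelBound (suc n) (suc n))
  small-static-equivalent {n} I =
    let q , q-covers , q≤ = small-cover (constraints-small I) (constraints-pointed I)
                                        {embed I} (embed-inCone I) (constraints I) id
    in  instanceOf q , instanceOf-equivalent I {q} q-covers ,
        ℕ.≤-trans (size-instanceOf q q≤) (ℕ.*-monoʳ-≤ (suc n) (bitLength-mono-≤ (ℕ.*-monoˡ-≤ _ length≤)))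
    where
    length≤ : length (constraints I) ℕ.≤ candidateCount n
    length≤ = ℕ.≤-trans (List.length-filter (λ a → 0ℤ ℤ.≤? a · embed I) (candidates n))
                        (ℕ.≤-reflexive (length-candidates n))

open Reduction using (small-static-equivalent; candidateCount)
open Siegel using (siegelBound)
open import Data.Nat using (_+_; _*_; _^_; _≤_; _<_)
open import Data.Nat.Properties
  using (≤-trans; ≤-reflexive; m≤m+n; *-monoʳ-≤; *-mono-≤; +-mono-≤; +-monoˡ-≤; ^-monoˡ-≤; ^-*-assoc;
         ^-distribˡ-+-*; m^n>0; ⌊n/2⌋+⌈n/2⌉≡n; ⌊n/2⌋≤⌈n/2⌉; module ≤-Reasoning)
open import Data.Nat.Logarithm using (⌈log₂_⌉; ⌊log₂⌋-mono-≤; ⌊log₂[2^n]⌋≡n; ⌈log₂⌉-mono-≤)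
open import Data.Nat.Logarithm.Core using (⌈log2⌉)
open import Data.Nat.Solver using (module +-*-Solver)
open import Induction.WellFounded using (Acc; acc)

n<2^n : ∀ n → n < 2 ^ n
n<2^n zero    = s≤s z≤n
n<2^n (suc n) = +-mono-≤ (m^n>0 2 n) (≤-trans (n<2^n n) (m≤m+n (2 ^ n) 0))

n≤2^⌈log₂n⌉ : ∀ n → n ≤ 2 ^ ⌈log₂ n ⌉
n≤2^⌈log₂n⌉ n = go n _
  where
  open +-*-Solver
  go : ∀ n (rec : Acc _<_ n) → n ≤ 2 ^ ⌈log2⌉ n rec
  go zero          _        = z≤n
  go (suc zero)    _        = s≤s z≤n
  go (suc (suc n)) (acc rs) = ≤-trans halves (*-monoʳ-≤ 2 (go (suc ℕ.⌈ n /2⌉) _))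
    where
    halves : suc (suc n) ≤ 2 * suc ℕ.⌈ n /2⌉
    halves = ≤-trans (s≤s (s≤s (≤-trans (≤-reflexive (sym (⌊n/2⌋+⌈n/2⌉≡n n))) (+-monoˡ-≤ _ (⌊n/2⌋≤⌈n/2⌉ n)))))
                     (≤-reflexive (solve 1 (λ h → con 2 :+ (h :+ h) := con 2 :* (con 1 :+ h)) refl ℕ.⌈ n /2⌉))

bitLength≤ : ∀ {k} t → k ≤ 2 ^ t → bitLength k ≤ suc t
bitLength≤ t k≤2^t = s≤s (≤-trans (⌊log₂⌋-mono-≤ k≤2^t) (≤-reflexive (⌊log₂[2^n]⌋≡n t)))

candidateCount≤ : ∀ n → candidateCount n ≤ 2 ^ (2 + n)
candidateCount≤ n = ≤-trans (+-monoˡ-≤ (2 ^ n + 2 ^ n) (n<2^n n))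
  (≤-trans (m≤m+n _ (2 ^ n))
           (≤-reflexive (solve 1 (λ x → x :+ (x :+ x) :+ x := con 2 :* (con 2 :* x)) refl (2 ^ n))))
  where open +-*-Solver

2n+3≤2^[3+⌈log₂n⌉] : ∀ n → 1 ≤ n → suc (2 * suc n) ≤ 2 ^ (3 + ⌈log₂ n ⌉)
2n+3≤2^[3+⌈log₂n⌉] (suc m) _ = ≤-trans 2n+3≤8n (*-monoʳ-≤ 2 (*-monoʳ-≤ 2 (*-monoʳ-≤ 2 (n≤2^⌈log₂n⌉ (suc m)))))
  where
  open +-*-Solver
  2n+3≤8n : suc (2 * suc (suc m)) ≤ 2 * (2 * (2 * suc m))
  2n+3≤8n = ≤-trans (m≤m+n _ (6 * m + 3))
    (≤-reflexive (solve 1 (λ m → con 1 :+ con 2 :* (con 2 :+ m) :+ (con 6 :* m :+ con 3)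
                              := con 2 :* (con 2 :* (con 2 :* (con 1 :+ m)))) refl m))

-- With n = m + 2 and ℓ = k + 1, the right-hand side exceeds the left-hand side by exactly slack.
polynomial-bound : ∀ n ℓ → 2 ≤ n → 1 ≤ ℓ → suc n * suc (2 + n + (3 + ℓ) * suc n) ≤ 22 * (n * n * ℓ)
polynomial-bound (suc (suc m)) (suc k) (s≤s (s≤s z≤n)) (s≤s z≤n) = ≤-trans (m≤m+n _ slack) (≤-reflexive (solve 2
  (λ m k → (con 3 :+ m) :* (con 1 :+ (con 4 :+ m :+ (con 4 :+ k) :* (con 3 :+ m)))
             :+ (con 17 :* (m :* m) :+ con 56 :* m :+ con 37
                 :+ con 21 :* (k :* (m :* m)) :+ con 82 :* (k :* m) :+ con 79 :* k)
           := con 22 :* ((con 2 :+ m) :* (con 2 :+ m) :* (con 1 :+ k))) refl m k))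
  where
  open +-*-Solver
  slack : ℕ
  slack = 17 * (m * m) + 56 * m + 37 + 21 * (k * (m * m)) + 82 * (k * m) + 79 * k

size-estimate : ∀ n → 2 ≤ n →
                suc n * bitLength (candidateCount n * siegelBound (suc n) (suc n)) ≤ 22 * (n * n * ⌈log₂ n ⌉)
size-estimate n 2≤n = begin
  suc n * bitLength (candidateCount n * siegelBound (suc n) (suc n))  ≤⟨ *-monoʳ-≤ (suc n) (bitLength≤ T encoding≤) ⟩
  suc n * suc T                                                       ≤⟨ polynomial-bound n ℓ 2≤n (⌈log₂⌉-mono-≤ 2≤n) ⟩
  22 * (n * n * ℓ)                                                    ∎
  where
  open ≤-Reasoning
  ℓ T : ℕ
  ℓ = ⌈log₂ n ⌉
  T = 2 + n + (3 + ℓ) * suc n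
  encoding≤ : candidateCount n * siegelBound (suc n) (suc n) ≤ 2 ^ T
  encoding≤ = begin
    candidateCount n * siegelBound (suc n) (suc n)
      ≤⟨ *-mono-≤ (candidateCount≤ n) (^-monoˡ-≤ (suc n) (2n+3≤2^[3+⌈log₂n⌉] n (≤-trans (s≤s z≤n) 2≤n))) ⟩
    2 ^ (2 + n) * (2 ^ (3 + ℓ)) ^ suc n  ≡⟨ cong (2 ^ (2 + n) *_) (^-*-assoc 2 (3 + ℓ) (suc n)) ⟩
    2 ^ (2 + n) * 2 ^ ((3 + ℓ) * suc n)  ≡⟨ sym (^-distribˡ-+-* 2 (2 + n) ((3 + ℓ) * suc n)) ⟩
    2 ^ T                                ∎

corollary3 : ∃[ c ] ∃[ n₀ ] ((n : ℕ) → n₀ ≤ n → (I : SubsetSum n) →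
               ∃[ J ] (StaticEquivalent I J × size J ≤ c * (n * n * ⌈log₂ n ⌉)))
corollary3 = 22 , 2 , λ n 2≤n I →
  let J , I≅J , size-J≤ = small-static-equivalent I
  in  J , I≅J , ≤-trans size-J≤ (size-estimate n 2≤n)
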